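{- None of the groups $S_3$ (symmetric group on 3 letters), $D_8$ (dihedral group of order 8) and $A_4$ (alternating group on 4 letters) has the non-covering property.
   Context: A group $G$ has the non-covering property if for all normal subgroups $M\subsetneq N$ of $G$ of finite index and all $g\in G$, there is $h\in gN$ such that for all $x\in G$, $x^{ -1}hx\notin gM$. -}

module Defs where

open import Agda.Builtin.FromNat
open import Data.Unit.Base using (⊤; tt)
open import Level using (Level; _⊔_; 0ℓ)
open import Data.Nat using (ℕ; zero; suc)
open import Data.Fin using (Fin; zero; suc; _≟_)
open import Data.Fin.Properties using (all?)
open import Data.Vec using (Vec; []; _∷_; lookup; tabulate)
open import Data.Vec.Properties using (≡-dec)
open import Data.Bool using (Bool; true; false; if_then_else_)
open import Data.Product using (Σ; ∃; ∃-syntax; _×_; _,_)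
open import Relation.Nullary using (¬_; Dec; yes; no)
open import Relation.Nullary.Decidable using (True; toWitness; _×-dec_; isYes)
open import Relation.Unary using (Pred; _⊆_)
open import Relation.Binary.PropositionalEquality
  using (_≡_; _≢_; refl; cong₂; isEquivalence)
open import Algebra.Bundles using (Group)
import Data.Fin.Literals as FinLit
import Data.Nat.Literals as NatLit

instance
  finNumber : ∀ {n} → Agda.Builtin.FromNat.Number (Fin n)
  finNumber = FinLit.number _
  natNumber : Agda.Builtin.FromNat.Number ℕ
  natNumber = NatLit.number

module _ {c ℓ} (G : Group c ℓ) where
  open Group G

  record IsNormalSubgroup {p} (N : Pred Carrier p) : Set (c ⊔ ℓ ⊔ p) where
    field
      respects : ∀ {x y} → x ≈ y → N x → N y
      ε∈       : N ε
      ∙∈       : ∀ {x y} → N x → N y → N (x ∙ y)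
      ⁻¹∈      : ∀ {x} → N x → N (x ⁻¹)
      conj∈    : ∀ g {x} → N x → N ((g ⁻¹ ∙ x) ∙ g)

  _∈_·_ : ∀ {p} → Carrier → Carrier → Pred Carrier p → Set p
  h ∈ g · N = N (g ⁻¹ ∙ h)

  HasFiniteIndex : ∀ {p} → Pred Carrier p → Set (c ⊔ p)
  HasFiniteIndex N =
    ∃[ k ] Σ (Fin k → Carrier) λ r → ∀ x → ∃[ i ] (x ∈ r i · N)

  _⊊_ : ∀ {p} → Pred Carrier p → Pred Carrier p → Set (c ⊔ p)
  M ⊊ N = (M ⊆ N) × (∃[ n ] (N n × ¬ M n))

  -- The non-covering property (subgroups ranging over predicates of
  -- level c ⊔ ℓ, i.e. over all subsets of the carrier).
  NonCovering : Set (Level.suc (c ⊔ ℓ))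
  NonCovering =
    (M N : Pred Carrier (c ⊔ ℓ)) →
    IsNormalSubgroup M → HasFiniteIndex M →
    IsNormalSubgroup N → HasFiniteIndex N →
    M ⊊ N →
    ∀ g → ∃[ h ] ((h ∈ g · N) × (∀ x → ¬ (((x ⁻¹ ∙ h) ∙ x) ∈ g · M)))

-- A permutation of {0,…,n-1} given by its list of images.
Perm : ℕ → Set
Perm n = Vec (Fin n) n

idPerm : ∀ {n} → Perm n
idPerm = tabulate (λ i → i)

_∘ₚ_ : ∀ {n} → Perm n → Perm n → Perm n
σ ∘ₚ τ = tabulate (λ i → lookup σ (lookup τ i))

_≟ₚ_ : ∀ {n} (σ τ : Perm n) → Dec (σ ≡ τ)
_≟ₚ_ = ≡-dec _≟_

-- first index satisfying a boolean test (default 0)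
firstIdx : ∀ {m} → (Fin (suc m) → Bool) → Fin (suc m)
firstIdx {zero}  f = zero
firstIdx {suc m} f = if f zero then zero else suc (firstIdx (λ i → f (suc i)))

-- The group whose elements are the permutations listed in `els`
-- (a list of distinct permutations closed under composition),
-- with multiplication given by composition of permutations.
module PermGroup {n k} (els : Vec (Perm n) (suc k)) where
  El : Set
  El = Fin (suc k)

  ⟦_⟧ : El → Perm n
  ⟦ a ⟧ = lookup els a

  find : Perm n → El
  find σ = firstIdx (λ i → isYes (⟦ i ⟧ ≟ₚ σ))

  _·_ : El → El → El
  a · b = find (⟦ a ⟧ ∘ₚ ⟦ b ⟧)

  e : El
  e = find idPerm

  inv : El → El
  inv a = firstIdx (λ b → isYes ((a · b) ≟ e))

  injective? : Dec (∀ a b → ⟦ a ⟧ ≡ ⟦ b ⟧ → a ≡ b)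
  injective? = all? λ a → all? λ b → dec a b
    where
    dec : ∀ a b → Dec (⟦ a ⟧ ≡ ⟦ b ⟧ → a ≡ b)
    dec a b with a ≟ b | ⟦ a ⟧ ≟ₚ ⟦ b ⟧
    ... | yes p | _     = yes (λ _ → p)
    ... | no _  | no q  = yes (λ r → Data.Empty.⊥-elim (q r))
      where import Data.Empty
    ... | no p  | yes q = no (λ f → p (f q))

  hom? : Dec (∀ a b → ⟦ a · b ⟧ ≡ ⟦ a ⟧ ∘ₚ ⟦ b ⟧)
  hom? = all? λ a → all? λ b → ⟦ a · b ⟧ ≟ₚ (⟦ a ⟧ ∘ₚ ⟦ b ⟧)

  unit? : Dec (⟦ e ⟧ ≡ idPerm)
  unit? = ⟦ e ⟧ ≟ₚ idPerm

  assoc? : Dec (∀ a b c → ((a · b) · c) ≡ (a · (b · c)))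
  assoc? = all? λ a → all? λ b → all? λ c → ((a · b) · c) ≟ (a · (b · c))

  identity? : Dec (∀ a → ((e · a) ≡ a) × ((a · e) ≡ a))
  identity? = all? λ a → ((e · a) ≟ a) ×-dec ((a · e) ≟ a)

  inverse? : Dec (∀ a → ((inv a · a) ≡ e) × ((a · inv a) ≡ e))
  inverse? = all? λ a → ((inv a · a) ≟ e) ×-dec ((a · inv a) ≟ e)

  module _ (as : True assoc?) (id : True identity?) (iv : True inverse?) where
    private
      A = toWitness as
      I = toWitness id
      V = toWitness iv
    group : Group 0ℓ 0ℓ
    group = record
      { Carrier = El ; _≈_ = _≡_ ; _∙_ = _·_ ; ε = e ; _⁻¹ = inv
      ; isGroup = record
        { isMonoid = record
          { isSemigroup = record
            { isMagma = record
              { isEquivalence = isEquivalence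
              ; ∙-cong = cong₂ _·_ }
            ; assoc = A }
          ; identity = (λ a → Data.Product.proj₁ (I a))
                     , (λ a → Data.Product.proj₂ (I a)) }
        ; inverse = (λ a → Data.Product.proj₁ (V a))
                  , (λ a → Data.Product.proj₂ (V a))
        ; ⁻¹-cong = λ { refl → refl } } }
      where import Data.Product

S₃-els : Vec (Perm 3) 6
S₃-els = (0 ∷ 1 ∷ 2 ∷ []) ∷ (1 ∷ 0 ∷ 2 ∷ []) ∷ (0 ∷ 2 ∷ 1 ∷ [])
       ∷ (2 ∷ 1 ∷ 0 ∷ []) ∷ (1 ∷ 2 ∷ 0 ∷ []) ∷ (2 ∷ 0 ∷ 1 ∷ []) ∷ []

-- the eight symmetries of a square with vertices 0,1,2,3 in cyclic order
-- (i ↦ i + r and i ↦ r - i modulo 4)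
D₈-els : Vec (Perm 4) 8
D₈-els = (0 ∷ 1 ∷ 2 ∷ 3 ∷ []) ∷ (1 ∷ 2 ∷ 3 ∷ 0 ∷ []) ∷ (2 ∷ 3 ∷ 0 ∷ 1 ∷ [])
       ∷ (3 ∷ 0 ∷ 1 ∷ 2 ∷ []) ∷ (0 ∷ 3 ∷ 2 ∷ 1 ∷ []) ∷ (1 ∷ 0 ∷ 3 ∷ 2 ∷ [])
       ∷ (2 ∷ 1 ∷ 0 ∷ 3 ∷ []) ∷ (3 ∷ 2 ∷ 1 ∷ 0 ∷ []) ∷ []

-- the twelve even permutations of {0,1,2,3}: identity, the three double
-- transpositions and the eight 3-cycles
A₄-els : Vec (Perm 4) 12
A₄-els = (0 ∷ 1 ∷ 2 ∷ 3 ∷ []) ∷ (1 ∷ 0 ∷ 3 ∷ 2 ∷ []) ∷ (2 ∷ 3 ∷ 0 ∷ 1 ∷ [])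
       ∷ (3 ∷ 2 ∷ 1 ∷ 0 ∷ [])
       ∷ (1 ∷ 2 ∷ 0 ∷ 3 ∷ []) ∷ (2 ∷ 0 ∷ 1 ∷ 3 ∷ [])
       ∷ (1 ∷ 3 ∷ 2 ∷ 0 ∷ []) ∷ (3 ∷ 0 ∷ 2 ∷ 1 ∷ [])
       ∷ (2 ∷ 1 ∷ 3 ∷ 0 ∷ []) ∷ (3 ∷ 1 ∷ 0 ∷ 2 ∷ [])
       ∷ (0 ∷ 2 ∷ 3 ∷ 1 ∷ []) ∷ (0 ∷ 3 ∷ 1 ∷ 2 ∷ []) ∷ []

module S₃M = PermGroup S₃-els
module D₈M = PermGroup D₈-els
module A₄M = PermGroup A₄-els

S₃ : Group 0ℓ 0ℓ
S₃ = S₃M.group _ _ _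

D₈ : Group 0ℓ 0ℓ
D₈ = D₈M.group _ _ _

A₄ : Group 0ℓ 0ℓ
A₄ = A₄M.group _ _ _

S₃-sane : (∀ a b → S₃M.⟦ a ⟧ ≡ S₃M.⟦ b ⟧ → a ≡ b)
        × (∀ a b → S₃M.⟦ S₃M._·_ a b ⟧ ≡ S₃M.⟦ a ⟧ ∘ₚ S₃M.⟦ b ⟧)
        × (S₃M.⟦ S₃M.e ⟧ ≡ idPerm)
S₃-sane = toWitness {a? = S₃M.injective?} _ , toWitness {a? = S₃M.hom?} _
        , toWitness {a? = S₃M.unit?} _

D₈-sane : (∀ a b → D₈M.⟦ a ⟧ ≡ D₈M.⟦ b ⟧ → a ≡ b)
        × (∀ a b → D₈M.⟦ D₈M._·_ a b ⟧ ≡ D₈M.⟦ a ⟧ ∘ₚ D₈M.⟦ b ⟧)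
        × (D₈M.⟦ D₈M.e ⟧ ≡ idPerm)
D₈-sane = toWitness {a? = D₈M.injective?} _ , toWitness {a? = D₈M.hom?} _
        , toWitness {a? = D₈M.unit?} _

A₄-sane : (∀ a b → A₄M.⟦ a ⟧ ≡ A₄M.⟦ b ⟧ → a ≡ b)
        × (∀ a b → A₄M.⟦ A₄M._·_ a b ⟧ ≡ A₄M.⟦ a ⟧ ∘ₚ A₄M.⟦ b ⟧)
        × (A₄M.⟦ A₄M.e ⟧ ≡ idPerm)
A₄-sane = toWitness {a? = A₄M.injective?} _ , toWitness {a? = A₄M.hom?} _
        , toWitness {a? = A₄M.unit?} _

-- Take M = 1 and N = A₃ ◁ S₃, N = Z(D₈) = ⟨r²⟩ ◁ D₈, N = V₄ ◁ A₄.  In each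
-- case a coset gN lies inside the conjugacy class of g: the transpositions in
-- S₃, {r, r³} in D₈, and the coset of a 3-cycle g modulo V₄, which V₄ permutes
-- transitively by conjugation.  So no h ∈ gN has all its conjugates outside
-- gM = {g}.  In a finite group every subgroup has finite index, and the
-- remaining closure and conjugacy conditions are decided by computation.
module Submission where

open import Defs
open import Agda.Builtin.FromNat
open import Data.Unit using (tt)
open import Level using (_⊔_; 0ℓ; Lift; lift)
open import Data.Nat using (suc)
open import Data.Fin using (Fin; _≟_)
open import Data.Fin.Properties using (any?; all?)
open import Data.Fin.Subset using (Subset; ⁅_⁆; _∪_)
open import Data.Fin.Subset.Properties using (_∈?_)
open import Data.Product using (_×_; _,_; proj₁; proj₂; ∃-syntax)
open import Data.Vec using (Vec)
open import Relation.Nullary using (¬_; Dec; ¬?)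
open import Relation.Nullary.Decidable using (True; toWitness; map′; _×-dec_; _→-dec_)
open import Relation.Unary using (Pred; Decidable)
open import Relation.Binary.PropositionalEquality as ≡ using (_≡_)
open import Algebra.Bundles using (Group)
import Algebra.Properties.Group as GroupProperties
import Relation.Binary.Reasoning.Setoid as SetoidReasoning

module _ {c ℓ} (G : Group c ℓ) where
  open Group G
  open GroupProperties G using (ε⁻¹≈ε)
  open SetoidReasoning setoid

  Trivial : Pred Carrier (c ⊔ ℓ)
  Trivial x = Lift c (x ≈ ε)

  trivial-isNormalSubgroup : IsNormalSubgroup G Trivial
  trivial-isNormalSubgroup = record
    { respects = λ x≈y (lift x≈ε) → lift (trans (sym x≈y) x≈ε)
    ; ε∈       = lift refl
    ; ∙∈       = λ (lift x≈ε) (lift y≈ε) → lift (trans (∙-cong x≈ε y≈ε) (identityˡ ε))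
    ; ⁻¹∈      = λ (lift x≈ε) → lift (trans (⁻¹-cong x≈ε) ε⁻¹≈ε)
    ; conj∈    = λ g (lift x≈ε) → lift (conj-ε g x≈ε)
    }
    where
    conj-ε : ∀ g {x} → x ≈ ε → (g ⁻¹ ∙ x) ∙ g ≈ ε
    conj-ε g {x} x≈ε = begin
      (g ⁻¹ ∙ x) ∙ g ≈⟨ ∙-congʳ (∙-congˡ x≈ε) ⟩
      (g ⁻¹ ∙ ε) ∙ g ≈⟨ ∙-congʳ (identityʳ (g ⁻¹)) ⟩
      g ⁻¹ ∙ g       ≈⟨ inverseˡ g ⟩
      ε              ∎

  Enumerates : ∀ {k} → (Fin k → Carrier) → Set (c ⊔ ℓ)
  Enumerates r = ∀ x → ∃[ i ] (r i ≈ x)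

  enumerates⇒hasFiniteIndex : ∀ {k p} {r : Fin k → Carrier} {N : Pred Carrier p} →
                              Enumerates r → IsNormalSubgroup G N → HasFiniteIndex G N
  enumerates⇒hasFiniteIndex {r = r} {N} enum N-normal = _ , r , λ x → inOwnCoset x (enum x)
    where
    open IsNormalSubgroup N-normal
    inOwnCoset : ∀ x → ∃[ i ] (r i ≈ x) → ∃[ i ] N (r i ⁻¹ ∙ x)
    inOwnCoset x (i , rᵢ≈x) =
      i , respects (trans (sym (inverseˡ x)) (∙-congʳ (⁻¹-cong (sym rᵢ≈x)))) ε∈

  CosetInConjugacyClass : ∀ {p} → Pred Carrier p → Carrier → Set (c ⊔ ℓ ⊔ p)
  CosetInConjugacyClass N g = ∀ h → N (g ⁻¹ ∙ h) → ∃[ x ] ((x ⁻¹ ∙ h) ∙ x ≈ g)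

  cosetInConjugacyClass⇒¬NonCovering :
    ∀ {k} {r : Fin k → Carrier} → Enumerates r →
    (N : Pred Carrier (c ⊔ ℓ)) → IsNormalSubgroup G N →
    ∀ {n} → N n → ¬ (n ≈ ε) →
    ∀ g → CosetInConjugacyClass N g → ¬ NonCovering G
  cosetInConjugacyClass⇒¬NonCovering enum N N-normal {n} n∈N n≉ε g coset⊆class nonCovering
    with nonCovering Trivial N
           trivial-isNormalSubgroup (enumerates⇒hasFiniteIndex enum trivial-isNormalSubgroup)
           N-normal (enumerates⇒hasFiniteIndex enum N-normal)
           ((λ (lift x≈ε) → respects (sym x≈ε) ε∈) , n , n∈N , λ (lift n≈ε) → n≉ε n≈ε) g
    where open IsNormalSubgroup N-normal
  ... | h , h∈gN , noConjugateIn-g1 with coset⊆class h h∈gN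
  ... | x , xhx≈g = noConjugateIn-g1 x (lift (trans (∙-congˡ xhx≈g) (inverseˡ g)))

module PermGroupDecisions {n k} (els : Vec (Perm n) (suc k))
  (as : True (PermGroup.assoc? els)) (id : True (PermGroup.identity? els))
  (iv : True (PermGroup.inverse? els)) where

  open PermGroup els using (El; group)
  open Group (group as id iv) using (ε; _∙_; _⁻¹)

  ClosedNormal : Pred El 0ℓ → Set
  ClosedNormal N = N ε × (∀ x y → N x → N y → N (x ∙ y)) × (∀ x → N x → N (x ⁻¹))
                 × (∀ g x → N x → N ((g ⁻¹ ∙ x) ∙ g))

  closedNormal? : ∀ {N : Pred El 0ℓ} → Decidable N → Dec (ClosedNormal N)
  closedNormal? N? =
    N? ε ×-dec all? (λ x → all? λ y → N? x →-dec N? y →-dec N? (x ∙ y))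
         ×-dec all? (λ x → N? x →-dec N? (x ⁻¹))
         ×-dec all? (λ g → all? λ x → N? x →-dec N? ((g ⁻¹ ∙ x) ∙ g))

  isNormalSubgroup? : ∀ {N : Pred El 0ℓ} → Decidable N → Dec (IsNormalSubgroup (group as id iv) N)
  isNormalSubgroup? {N} N? = map′ toRecord fromRecord (closedNormal? N?)
    where
    toRecord : ClosedNormal N → IsNormalSubgroup (group as id iv) N
    toRecord (ε∈ , ∙∈ , ⁻¹∈ , conj∈) = record
      { respects = λ { ≡.refl x∈N → x∈N }
      ; ε∈ = ε∈ ; ∙∈ = ∙∈ _ _ ; ⁻¹∈ = ⁻¹∈ _ ; conj∈ = λ g → conj∈ g _ }
    fromRecord : IsNormalSubgroup (group as id iv) N → ClosedNormal N
    fromRecord N-normal = ε∈ , (λ _ _ → ∙∈) , (λ _ → ⁻¹∈) , (λ g _ → conj∈ g)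
      where open IsNormalSubgroup N-normal

  cosetInConjugacyClass? : ∀ {N : Pred El 0ℓ} → Decidable N → ∀ g →
                           Dec (CosetInConjugacyClass (group as id iv) N g)
  cosetInConjugacyClass? N? g = all? λ h → N? (g ⁻¹ ∙ h) →-dec any? λ x → (x ⁻¹ ∙ h) ∙ x ≟ g

  -- The conclusion is stated for any G equal to the listed group: for G = S₃
  -- (a module copy of it) a direct ascription makes Agda compare the unfolded
  -- NonCovering types, normalising the multiplication tables.
  ¬NonCovering-decided :
    ∀ {N : Pred El 0ℓ} (N? : Decidable N) g m →
    True (isNormalSubgroup? N?) → True (cosetInConjugacyClass? N? g) →
    True (N? m ×-dec ¬? (m ≟ ε)) →
    ∀ {G} → group as id iv ≡ G → ¬ NonCovering G
  ¬NonCovering-decided {N} N? g m N-normal coset⊆class m∈N∖ε ≡.refl =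
    cosetInConjugacyClass⇒¬NonCovering _ {r = λ x → x} (λ x → x , ≡.refl) N
      (toWitness N-normal) (proj₁ m∈N×m≢ε) (proj₂ m∈N×m≢ε) g (toWitness coset⊆class)
    where
    m∈N×m≢ε = toWitness m∈N∖ε

A₃ : Subset 6
A₃ = ⁅ 0 ⁆ ∪ ⁅ 4 ⁆ ∪ ⁅ 5 ⁆

Z₂ : Subset 8
Z₂ = ⁅ 0 ⁆ ∪ ⁅ 2 ⁆

V₄ : Subset 12
V₄ = ⁅ 0 ⁆ ∪ ⁅ 1 ⁆ ∪ ⁅ 2 ⁆ ∪ ⁅ 3 ⁆

proposition4p10 : (¬ NonCovering S₃) × (¬ NonCovering D₈) × (¬ NonCovering A₄)
proposition4p10 =
    PermGroupDecisions.¬NonCovering-decided S₃-els tt tt tt (_∈? A₃) 1 4 _ _ _ {S₃} ≡.refl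
  , PermGroupDecisions.¬NonCovering-decided D₈-els tt tt tt (_∈? Z₂) 1 2 _ _ _ {D₈} ≡.refl
  , PermGroupDecisions.¬NonCovering-decided A₄-els tt tt tt (_∈? V₄) 4 1 _ _ _ {A₄} ≡.refl
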